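{- Let $p$ be an odd prime, let $a$ be a positive integer, and let $\mathcal{O}$ be an imaginary quadratic order of discriminant $\Delta$ with $\left(\frac{\Delta}{p}\right)=0$. Let $P\in\mathcal{O}/p^a\mathcal{O}$ be an element of additive order $p^a$. Then, as abelian groups, $M_P\cong\mathbb{Z}/p^a\mathbb{Z}\times\mathbb{Z}/p^b\mathbb{Z}$ for some integer $0\le b\le a$, and the orbit of $P$ under $C_{p^a}(\mathcal{O})$ has size $p^{a+b-1}(p-1)$.
   Context: For an order $\mathcal{O}$ and positive integer $N$, $C_N(\mathcal{O}):=(\mathcal{O}/N\mathcal{O})^\times$, acting on $\mathcal{O}/N\mathcal{O}$ by multiplication. For $P\in\mathcal{O}/N\mathcal{O}$, $M_P:=\{xP: x\in\mathcal{O}\}$ is the $\mathcal{O}$-submodule generated by $P$. The discriminant of an order of conductor $\mathfrak f$ in $K$ is $\mathfrak f^2\Delta_K$. -}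

module Defs where

open import Data.Nat as ℕ using (ℕ)
open import Data.Integer using (ℤ; +_; _+_; _-_; _*_)
open import Data.Integer.Divisibility using (_∣_)
open import Data.Product using (Σ; ∃; _×_; _,_)
open import Data.Fin using (Fin)
open import Relation.Binary.PropositionalEquality using (_≡_)
open import Relation.Nullary using (¬_)
open import Function.Bundles using (_⇔_)

-- An imaginary quadratic order O = ℤ[ω] where ω² = t·ω − n, t² − 4n < 0.
-- Every imaginary quadratic order has such a presentation, and its
-- discriminant is t² − 4n.  Elements x + yω are pairs (x , y) of integers.
Elt : Set
Elt = ℤ × ℤ

disc : ℤ → ℤ → ℤ
disc t n = t * t - + 4 * n

mulO : ℤ → ℤ → Elt → Elt → Elt
mulO t n (x₁ , y₁) (x₂ , y₂) =
  (x₁ * x₂ - y₁ * y₂ * n , x₁ * y₂ + x₂ * y₁ + y₁ * y₂ * t)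

addO : Elt → Elt → Elt
addO (x₁ , y₁) (x₂ , y₂) = (x₁ + x₂ , y₁ + y₂)

smul : ℤ → Elt → Elt
smul k (x , y) = (k * x , k * y)

zeroO oneO : Elt
zeroO = (+ 0 , + 0)
oneO = (+ 1 , + 0)

-- congruence modulo N·O, i.e. equality in O/NO
_≈[_]_ : Elt → ℕ → Elt → Set
(x₁ , y₁) ≈[ N ] (x₂ , y₂) = ((+ N) ∣ (x₁ - x₂)) × ((+ N) ∣ (y₁ - y₂))

IsUnit : ℤ → ℤ → ℕ → Elt → Set
IsUnit t n N u = ∃ λ v → mulO t n u v ≈[ N ] oneO

HasAddOrder : ℕ → Elt → ℕ → Set
HasAddOrder N P m =
  (1 ℕ.≤ m) × (smul (+ m) P ≈[ N ] zeroO)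
  × (∀ k → 1 ℕ.≤ k → k ℕ.< m → ¬ (smul (+ k) P ≈[ N ] zeroO))

InM : ℤ → ℤ → ℕ → Elt → Elt → Set
InM t n N P Q = ∃ λ x → mulO t n x P ≈[ N ] Q

InOrbit : ℤ → ℤ → ℕ → Elt → Elt → Set
InOrbit t n N P Q = ∃ λ u → IsUnit t n N u × (mulO t n u P ≈[ N ] Q)

-- The subgroup S of O/NO (closed under +) is isomorphic as an abelian group
-- to ℤ/m × ℤ/k: there are g₁ g₂ ∈ S such that (i , j) ↦ i·g₁ + j·g₂ induces
-- an isomorphism ℤ/m × ℤ/k → S (kernel exactly mℤ × kℤ, and surjective).
IsoCyc² : ℕ → (Elt → Set) → ℕ → ℕ → Set
IsoCyc² N S m k =
  Σ Elt λ g₁ → Σ Elt λ g₂ → S g₁ × S g₂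
  × (∀ i j → (addO (smul i g₁) (smul j g₂) ≈[ N ] zeroO)
               ⇔ (((+ m) ∣ i) × ((+ k) ∣ j)))
  × (∀ Q → S Q → ∃ λ i → ∃ λ j → addO (smul i g₁) (smul j g₂) ≈[ N ] Q)

-- The set of classes of O/NO satisfying S (≈-invariant) has exactly c elements:
-- an injective enumeration Fin c → S/≈ that hits every class.
ClassCount : ℕ → (Elt → Set) → ℕ → Set
ClassCount N S c =
  Σ (Fin c → Elt) λ f → (∀ i → S (f i))
  × (∀ i j → f i ≈[ N ] f j → i ≡ j)
  × (∀ Q → S Q → ∃ λ i → f i ≈[ N ] Q)

{-# OPTIONS --safe #-}
-- Write O = ℤ[ω] with ω² = tω − n and let 2h ≡ t (mod p).  Since p divides the discriminant,
-- 4·N(c + dω) ≡ (2(c + hd))² (mod p), so c + dω is a unit modulo p^a exactly when p ∤ c + hd: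
-- the units are parametrised by a residue u prime to p and an arbitrary d, with c = u − hd.
-- If P is a unit, M_P is all of O/p^aO ≅ (ℤ/p^a)² and the orbit is (units)·P, so b = a.
-- Otherwise P = x + yω with p ∤ y (P has order p^a), and for c₀ = (x + ty)/y the element
-- (ω − c₀)P is congruent to an integer w = q·p^e with p ∤ q or e = a.  Then
-- (c + dω)P = (c + dc₀)P + dq·p^e, so M_P is generated by P and p^e with relations exactly
-- p^a·P = 0 and p^(a−e)·p^e = 0, giving b = a − e; the orbit is {uP + j·p^e} with u a unit
-- residue and j modulo p^b, of size p^(a−1)(p − 1)·p^b.
module Submission where

open import Defs
open import Data.Nat using (ℕ; suc; _^_)
open import Data.Nat.Primality using (Prime)
open import Data.Integer using (ℤ; +_; 0ℤ)
open import Relation.Binary.PropositionalEquality using (_≢_)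

module Congruence where
  open import Data.Nat as ℕ using (ℕ)
  import Data.Nat.Divisibility as ℕ
  open import Data.Integer using (ℤ; +_; _+_; _-_; _*_; -_; 0ℤ)
  import Data.Integer.Properties as ℤ
  open import Data.Integer.Divisibility.Signed
  open import Data.Integer.Tactic.RingSolver using (solve-∀)
  open import Relation.Binary.Bundles using (Setoid)
  open import Relation.Binary.Structures using (IsEquivalence)
  open import Relation.Binary.PropositionalEquality using (_≡_; refl; subst; subst₂; sym; trans)

  infix 4 _≡[_]_

  record _≡[_]_ (a : ℤ) (m : ℕ) (b : ℤ) : Set where
    constructor mod
    field m∣a-b : + m ∣ a - b

  open _≡[_]_ public

  module _ {m : ℕ} where

    ≡⇒≡-mod : ∀ {a b} → a ≡ b → a ≡[ m ] b
    ≡⇒≡-mod {a} refl = mod (divides 0ℤ (trans (ℤ.+-inverseʳ a) (sym (ℤ.*-zeroˡ (+ m)))))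

    ≡-mod-isEquivalence : IsEquivalence (λ a b → a ≡[ m ] b)
    ≡-mod-isEquivalence = record
      { refl = ≡⇒≡-mod refl
      ; sym = λ {a} {b} (mod d) → mod (subst (+ m ∣_) (negate a b) (∣m⇒∣-m d))
      ; trans = λ {a} {b} {c} (mod d) (mod e) → mod (subst (+ m ∣_) (telescope a b c) (∣m∣n⇒∣m+n d e))
      }
      where
      negate : ∀ a b → - (a - b) ≡ b - a
      negate = solve-∀
      telescope : ∀ a b c → (a - b) + (b - c) ≡ a - c
      telescope = solve-∀

  ≡-mod-setoid : ℕ → Setoid _ _
  ≡-mod-setoid m = record { isEquivalence = ≡-mod-isEquivalence {m} }

  module _ {m : ℕ} where
    open IsEquivalence (≡-mod-isEquivalence {m}) public
      renaming (refl to ≡-mod-refl; sym to ≡-mod-sym; trans to ≡-mod-trans)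

    +-cong-mod : ∀ {a a′ b b′} → a ≡[ m ] a′ → b ≡[ m ] b′ → a + b ≡[ m ] a′ + b′
    +-cong-mod {a} {a′} {b} {b′} (mod d) (mod e) = mod (subst (+ m ∣_) (regroup a a′ b b′) (∣m∣n⇒∣m+n d e))
      where
      regroup : ∀ a a′ b b′ → (a - a′) + (b - b′) ≡ (a + b) - (a′ + b′)
      regroup = solve-∀

    neg-cong-mod : ∀ {a a′} → a ≡[ m ] a′ → - a ≡[ m ] - a′
    neg-cong-mod {a} {a′} (mod d) = mod (subst (+ m ∣_) (regroup a a′) (∣m⇒∣-m d))
      where
      regroup : ∀ a a′ → - (a - a′) ≡ (- a) - (- a′)
      regroup = solve-∀

    +-congˡ-mod : ∀ c {b b′} → b ≡[ m ] b′ → c + b ≡[ m ] c + b′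
    +-congˡ-mod c = +-cong-mod (≡-mod-refl {c})

    -‿cong-mod : ∀ {a a′ b b′} → a ≡[ m ] a′ → b ≡[ m ] b′ → a - b ≡[ m ] a′ - b′
    -‿cong-mod a≡a′ b≡b′ = +-cong-mod a≡a′ (neg-cong-mod b≡b′)

    *-cong-mod : ∀ {a a′ b b′} → a ≡[ m ] a′ → b ≡[ m ] b′ → a * b ≡[ m ] a′ * b′
    *-cong-mod {a} {a′} {b} {b′} (mod d) (mod e) =
      mod (subst (+ m ∣_) (regroup a a′ b b′) (∣m∣n⇒∣m+n (∣n⇒∣m*n a e) (∣m⇒∣m*n b′ d)))
      where
      regroup : ∀ a a′ b b′ → a * (b - b′) + (a - a′) * b′ ≡ a * b - a′ * b′
      regroup = solve-∀

    *-congˡ-mod : ∀ c {b b′} → b ≡[ m ] b′ → c * b ≡[ m ] c * b′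
    *-congˡ-mod c = *-cong-mod (≡-mod-refl {c})

    *-congʳ-mod : ∀ c {b b′} → b ≡[ m ] b′ → b * c ≡[ m ] b′ * c
    *-congʳ-mod c b≡b′ = *-cong-mod b≡b′ (≡-mod-refl {c})

    ∣⇒≡0-mod : ∀ {a} → + m ∣ a → a ≡[ m ] 0ℤ
    ∣⇒≡0-mod {a} d = mod (subst (+ m ∣_) (sym (ℤ.+-identityʳ a)) d)

    ≡0-mod⇒∣ : ∀ {a} → a ≡[ m ] 0ℤ → + m ∣ a
    ≡0-mod⇒∣ {a} (mod d) = subst (+ m ∣_) (ℤ.+-identityʳ a) d

    ∣-resp-≡-mod : ∀ {a b} → a ≡[ m ] b → + m ∣ a → + m ∣ b
    ∣-resp-≡-mod {a} {b} (mod d) m∣a = subst (+ m ∣_) (cancel a b) (∣m∣n⇒∣m-n m∣a d)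
      where
      cancel : ∀ a b → a - (a - b) ≡ b
      cancel = solve-∀

    a+k*m≡[m]a : ∀ a k → a + k * + m ≡[ m ] a
    a+k*m≡[m]a a k = mod (divides k (cancel a k (+ m)))
      where
      cancel : ∀ a k m → a + k * m - a ≡ k * m
      cancel = solve-∀

  ≡-mod⇒-≡0 : ∀ {m a b} → a ≡[ m ] b → a - b ≡[ m ] 0ℤ
  ≡-mod⇒-≡0 (mod d) = ∣⇒≡0-mod d

  -≡0⇒≡-mod : ∀ {m a b} → a - b ≡[ m ] 0ℤ → a ≡[ m ] b
  -≡0⇒≡-mod a-b≡0 = mod (≡0-mod⇒∣ a-b≡0)

  private
    *-distribʳ-difference : ∀ a b k → (a - b) * k ≡ a * k - b * k
    *-distribʳ-difference = solve-∀

  ≡-mod-1 : ∀ {a b} → a ≡[ 1 ] b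
  ≡-mod-1 {a} {b} = mod (divides (a - b) (sym (ℤ.*-identityʳ (a - b))))

  *-scale-mod : ∀ {m a b} k → a ≡[ m ] b → a * + k ≡[ m ℕ.* k ] b * + k
  *-scale-mod {m} {a} {b} k (mod d) =
    mod (subst₂ _∣_ (sym (ℤ.pos-* m k)) (*-distribʳ-difference a b (+ k)) (*-monoˡ-∣ (+ k) d))

  *-unscale-mod : ∀ {m a b} k .{{_ : ℕ.NonZero k}} → a * + k ≡[ m ℕ.* k ] b * + k → a ≡[ m ] b
  *-unscale-mod {m} {a} {b} k (mod d) =
    mod (*-cancelʳ-∣ (+ k) (subst₂ _∣_ (ℤ.pos-* m k) (sym (*-distribʳ-difference a b (+ k))) d))

  ≡-mod-∣ : ∀ {k m a b} → k ℕ.∣ m → a ≡[ m ] b → a ≡[ k ] b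
  ≡-mod-∣ k∣m (mod d) = mod (∣-trans (∣ᵤ⇒∣ k∣m) d)

  module ≡-mod-Reasoning (m : ℕ) where
    open import Relation.Binary.Reasoning.Setoid (≡-mod-setoid m) public

open Congruence using (_≡[_]_)

module Invertibility where
  open import Data.Nat as ℕ using (ℕ; zero; suc; _^_)
  import Data.Nat.Divisibility as ℕ
  open import Data.Nat.Coprimality using (Coprime; coprime-divisor; coprime-Bézout)
  import Data.Nat.Coprimality as Coprime
  open import Data.Nat.GCD using (module Bézout)
  open import Data.Integer using (ℤ; +_; _+_; _-_; _*_; -_; 1ℤ; ∣_∣)
  import Data.Integer.Properties as ℤ
  open import Data.Integer.Tactic.RingSolver using (solve-∀)
  open import Data.Product using (∃; _,_)
  open import Data.Sum using (inj₁; inj₂)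
  open import Relation.Binary.PropositionalEquality using (_≡_; cong; sym; trans; subst)
  open Congruence

  coprime-* : ∀ {m a b} → Coprime m a → Coprime m b → Coprime m (a ℕ.* b)
  coprime-* {m} {a} {b} m⊥a m⊥b (d∣m , d∣ab) = m⊥b (d∣m , coprime-divisor d⊥a d∣ab)
    where
    d⊥a : Coprime _ a
    d⊥a (c∣d , c∣a) = m⊥a (ℕ.∣-trans c∣d d∣m , c∣a)

  coprime-^ : ∀ {m a} k → Coprime m a → Coprime m (a ^ k)
  coprime-^ {m} zero _ = Coprime.sym (Coprime.1-coprimeTo m)
  coprime-^ (suc k) m⊥a = coprime-* m⊥a (coprime-^ k m⊥a)

  bézout⇒invertible : ∀ {a m} → Bézout.Identity 1 a m → ∃ λ v → + a * v ≡[ m ] 1ℤ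
  bézout⇒invertible {a} {m} (Bézout.+- x y eq) = + x , (begin
    + a * + x               ≡⟨ ℤ.*-comm (+ a) (+ x) ⟩
    + x * + a               ≡⟨ ℤ.pos-* x a ⟨
    + (x ℕ.* a)             ≡⟨ cong +_ eq ⟨
    + (1 ℕ.+ y ℕ.* m)       ≡⟨ trans (ℤ.pos-+ 1 (y ℕ.* m)) (cong (λ z → 1ℤ + z) (ℤ.pos-* y m)) ⟩
    1ℤ + + y * + m          ≈⟨ a+k*m≡[m]a 1ℤ (+ y) ⟩
    1ℤ                      ∎)
    where open ≡-mod-Reasoning m
  bézout⇒invertible {a} {m} (Bézout.-+ x y eq) = - + x , (begin
    + a * - + x               ≡⟨ regroup (+ a) (+ x) ⟩
    1ℤ - (1ℤ + + x * + a)     ≡⟨ cong (λ z → 1ℤ - (1ℤ + z)) (ℤ.pos-* x a) ⟨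
    1ℤ - + (1 ℕ.+ x ℕ.* a)    ≡⟨ cong (λ z → 1ℤ - + z) eq ⟩
    1ℤ - + (y ℕ.* m)          ≡⟨ cong (λ z → 1ℤ - z) (ℤ.pos-* y m) ⟩
    1ℤ - + y * + m            ≡⟨ cong (λ z → 1ℤ + z) (ℤ.neg-distribˡ-* (+ y) (+ m)) ⟩
    1ℤ + - + y * + m          ≈⟨ a+k*m≡[m]a 1ℤ (- + y) ⟩
    1ℤ                        ∎)
    where
    open ≡-mod-Reasoning m
    regroup : ∀ a x → a * - x ≡ 1ℤ - (1ℤ + x * a)
    regroup = solve-∀

  coprime⇒invertible : ∀ {m} u → Coprime ∣ u ∣ m → ∃ λ v → u * v ≡[ m ] 1ℤ
  coprime⇒invertible {m} u u⊥m with bézout⇒invertible (coprime-Bézout u⊥m) | ℤ.+∣i∣≡i⊎+∣i∣≡-i u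
  ... | v , ∣u∣v≡1 | inj₁ ∣u∣≡u  = v , subst (λ z → z * v ≡[ m ] 1ℤ) ∣u∣≡u ∣u∣v≡1
  ... | v , ∣u∣v≡1 | inj₂ ∣u∣≡-u =
    - v , subst (λ z → z ≡[ m ] 1ℤ) (trans (cong (_* v) ∣u∣≡-u) (flip u v)) ∣u∣v≡1
    where
    flip : ∀ u v → - u * v ≡ u * - v
    flip = solve-∀

module PrimeModulus (p : ℕ) (p-prime : Prime p) where
  open import Data.Nat as ℕ using (ℕ; zero; suc; _^_; _≤_)
  import Data.Nat.Divisibility as ℕ
  import Data.Nat.Properties as ℕ
  open import Data.Nat.Primality using (Prime; euclidsLemma; prime⇒irreducible; ¬prime[1]; irreducible[2])
  open import Data.Nat.Coprimality using (Coprime)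
  open import Data.Integer using (ℤ; +_; _*_; 0ℤ; 1ℤ; ∣_∣)
  import Data.Integer.Properties as ℤ
  open import Data.Integer.Divisibility.Signed
  open import Data.Product using (Σ; ∃; _×_; _,_)
  open import Data.Sum using (_⊎_; inj₁; inj₂)
  open import Data.Empty using (⊥-elim)
  open import Relation.Nullary using (¬_; yes; no)
  open import Relation.Binary.PropositionalEquality using (_≡_; _≢_; refl; cong; sym; subst; module ≡-Reasoning)
  open Congruence
  open Invertibility

  p∣*∧p∤⇒p∣ : ∀ a b → + p ∣ a * b → ¬ + p ∣ a → + p ∣ b
  p∣*∧p∤⇒p∣ a b p∣ab p∤a with euclidsLemma ∣ a ∣ ∣ b ∣ p-prime (subst (p ℕ.∣_) (ℤ.abs-* a b) (∣⇒∣ᵤ p∣ab))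
  ... | inj₁ p∣a = ⊥-elim (p∤a (∣ᵤ⇒∣ p∣a))
  ... | inj₂ p∣b = ∣ᵤ⇒∣ p∣b

  p∤*p∤⇒p∤* : ∀ {a b} → ¬ + p ∣ a → ¬ + p ∣ b → ¬ + p ∣ a * b
  p∤*p∤⇒p∤* {a} {b} p∤a p∤b p∣ab = p∤b (p∣*∧p∤⇒p∣ a b p∣ab p∤a)

  p∣²⇒p∣ : ∀ a → + p ∣ a * a → + p ∣ a
  p∣²⇒p∣ a p∣aa with + p ∣? a
  ... | yes p∣a = p∣a
  ... | no p∤a = p∣*∧p∤⇒p∣ a a p∣aa p∤a

  p∤1 : ¬ + p ∣ 1ℤ
  p∤1 p∣1 = ¬prime[1] (subst Prime (ℕ.∣1⇒≡1 (∣⇒∣ᵤ p∣1)) p-prime)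

  odd⇒p∤2 : p ≢ 2 → ¬ + p ∣ + 2
  odd⇒p∤2 p≢2 p∣2 with irreducible[2] (∣⇒∣ᵤ p∣2)
  ... | inj₁ p≡1 = ¬prime[1] (subst Prime p≡1 p-prime)
  ... | inj₂ p≡2 = p≢2 p≡2

  p∤⇒coprime : ∀ {u} → ¬ + p ∣ u → Coprime ∣ u ∣ p
  p∤⇒coprime p∤u (d∣u , d∣p) with prime⇒irreducible p-prime d∣p
  ... | inj₁ d≡1 = d≡1
  ... | inj₂ refl = ⊥-elim (p∤u (∣ᵤ⇒∣ d∣u))

  p∤⇒invertible-mod-p : ∀ {u} → ¬ + p ∣ u → ∃ λ v → u * v ≡[ p ] 1ℤ
  p∤⇒invertible-mod-p {u} p∤u = coprime⇒invertible u (p∤⇒coprime p∤u)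

  p∤⇒invertible : ∀ {u} k → ¬ + p ∣ u → ∃ λ v → u * v ≡[ p ^ k ] 1ℤ
  p∤⇒invertible {u} k p∤u = coprime⇒invertible u (coprime-^ k (p∤⇒coprime p∤u))

  capped-valuation : ∀ w k → Σ ℕ λ e → e ≤ k × Σ ℤ λ q → w ≡ q * + (p ^ e) × (e ≡ k ⊎ ¬ + p ∣ q)
  capped-valuation w zero = 0 , ℕ.z≤n , w , sym (ℤ.*-identityʳ w) , inj₁ refl
  capped-valuation w (suc k) with capped-valuation w k
  ... | e , e≤k , q , w≡qpᵉ , inj₂ p∤q = e , ℕ.m≤n⇒m≤1+n e≤k , q , w≡qpᵉ , inj₂ p∤q
  ... | .k , _ , q , w≡qpᵏ , inj₁ refl with + p ∣? q
  ...   | no p∤q = k , ℕ.n≤1+n k , q , w≡qpᵏ , inj₂ p∤q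
  ...   | yes (divides r q≡rp) = suc k , ℕ.≤-refl , r , w≡rpᵏ⁺¹ , inj₁ refl
    where
    w≡rpᵏ⁺¹ : w ≡ r * + (p ^ suc k)
    w≡rpᵏ⁺¹ = begin
      w                       ≡⟨ w≡qpᵏ ⟩
      q * + (p ^ k)           ≡⟨ cong (_* + (p ^ k)) q≡rp ⟩
      r * + p * + (p ^ k)     ≡⟨ ℤ.*-assoc r (+ p) (+ (p ^ k)) ⟩
      r * (+ p * + (p ^ k))   ≡⟨ cong (r *_) (ℤ.pos-* p (p ^ k)) ⟨
      r * + (p ^ suc k)       ∎
      where open ≡-Reasoning

  valuation-decomposition : ∀ w k → Σ ℕ λ e → e ≤ k
    × Σ ℤ λ q → w ≡ q * + (p ^ e) × ∃ λ κ → q * κ ≡[ p ^ (k ℕ.∸ e) ] 1ℤ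
  valuation-decomposition w k with capped-valuation w k
  ... | e , e≤k , q , w≡qpᵉ , inj₂ p∤q = e , e≤k , q , w≡qpᵉ , p∤⇒invertible (k ℕ.∸ e) p∤q
  ... | .k , k≤k , q , w≡qpᵏ , inj₁ refl =
    k , k≤k , q , w≡qpᵏ , 0ℤ , subst (λ i → q * 0ℤ ≡[ p ^ i ] 1ℤ) (sym (ℕ.n∸n≡0 k)) ≡-mod-1

module Residues where
  open import Data.Nat as ℕ using (ℕ; zero; suc; NonZero; _^_)
  import Data.Nat.Properties as ℕ
  import Data.Nat.DivMod as ℕ
  import Data.Nat.Divisibility as ℕ
  open import Data.Fin using (Fin; zero; suc; toℕ; fromℕ<; combine; remQuot)
  import Data.Fin.Properties as Fin
  open import Data.Integer using (ℤ; +_; _+_; _-_; _*_; -_; ∣_∣)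
  import Data.Integer.Properties as ℤ
  open import Data.Integer.DivMod using (_%ℕ_; _/ℕ_; n%ℕd<d; a≡a%ℕn+[a/ℕn]*n)
  open import Data.Integer.Divisibility.Signed using (_∣_; ∣⇒∣ᵤ; ∣ᵤ⇒∣)
  open import Data.Product using (∃; _,_; proj₁; proj₂; uncurry)
  open import Data.Empty using (⊥-elim)
  open import Function using (_∘_)
  open import Relation.Nullary using (¬_)
  open import Relation.Binary.PropositionalEquality using (_≡_; refl; cong; sym; trans; subst; module ≡-Reasoning)
  open Congruence

  remQuot-injective : ∀ {m} n (i j : Fin (m ℕ.* n)) → remQuot {m} n i ≡ remQuot n j → i ≡ j
  remQuot-injective {m} n i j qr≡ = begin
    i                                  ≡⟨ Fin.combine-remQuot {m} n i ⟨
    uncurry combine (remQuot {m} n i)  ≡⟨ cong (uncurry combine) qr≡ ⟩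
    uncurry combine (remQuot {m} n j)  ≡⟨ Fin.combine-remQuot {m} n j ⟩
    j                                  ∎
    where open ≡-Reasoning

  <-≡-mod⇒≡ : ∀ {M u v} → u ℕ.< M → v ℕ.< M → + u ≡[ M ] + v → u ≡ v
  <-≡-mod⇒≡ {M} {u} {v} u<M v<M (mod M∣u-v) =
    ℤ.+-injective (ℤ.i-j≡0⇒i≡j (+ u) (+ v) (ℤ.∣i∣≡0⇒i≡0 ∣u-v∣≡0))
    where
    instance
      M≢0 : NonZero M
      M≢0 = ℕ.>-nonZero (ℕ.≤-<-trans ℕ.z≤n u<M)
    ∣u-v∣<M : ∣ + u - + v ∣ ℕ.< M
    ∣u-v∣<M = subst (ℕ._< M) (cong ∣_∣ (sym (ℤ.[+m]-[+n]≡m⊖n u v)))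
                (ℕ.≤-<-trans (ℤ.∣m⊝n∣≤m⊔n u v) (ℕ.⊔-lub u<M v<M))
    ∣u-v∣≡0 : ∣ + u - + v ∣ ≡ 0
    ∣u-v∣≡0 = trans (sym (ℕ.m<n⇒m%n≡m ∣u-v∣<M)) (ℕ.n∣m⇒m%n≡0 _ M (∣⇒∣ᵤ M∣u-v))

  toℕ-≡-mod-injective : ∀ {M} (i j : Fin M) → + toℕ i ≡[ M ] + toℕ j → i ≡ j
  toℕ-≡-mod-injective i j i≡j = Fin.toℕ-injective (<-≡-mod⇒≡ (Fin.toℕ<n i) (Fin.toℕ<n j) i≡j)

  residue : ∀ M .{{_ : NonZero M}} z → ∃ λ (j : Fin M) → + toℕ j ≡[ M ] z
  residue M z = fromℕ< (n%ℕd<d z M) , (begin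
    + toℕ (fromℕ< (n%ℕd<d z M))       ≡⟨ cong +_ (Fin.toℕ-fromℕ< (n%ℕd<d z M)) ⟩
    + (z %ℕ M)                         ≈⟨ a+k*m≡[m]a (+ (z %ℕ M)) (z /ℕ M) ⟨
    + (z %ℕ M) + (z /ℕ M) * + M        ≡⟨ a≡a%ℕn+[a/ℕn]*n z M ⟨
    z                                  ∎)
    where open ≡-mod-Reasoning M

  module PrimeTo (p₁ a : ℕ) where
    p : ℕ
    p = suc p₁

    N : ℕ
    N = p ^ suc a

    instance
      N≢0 : NonZero N
      N≢0 = ℕ.m^n≢0 p (suc a)

    combine<N : (c : Fin (p ^ a ℕ.* p)) → toℕ c ℕ.< N
    combine<N c = subst (toℕ c ℕ.<_) (ℕ.*-comm (p ^ a) p) (Fin.toℕ<n c)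

    p∤p*q+suc : ∀ q (r : Fin p₁) → ¬ + p ∣ + (p ℕ.* q ℕ.+ suc (toℕ r))
    p∤p*q+suc q r p∣ = ℕ.<⇒≱ (ℕ.s<s (Fin.toℕ<n r)) (ℕ.∣⇒≤ (ℕ.∣m+n∣m⇒∣n (∣⇒∣ᵤ p∣) (ℕ.m∣m*n q)))

    digitsResidue : Fin (p ^ a) → Fin p₁ → ℤ
    digitsResidue q r = + toℕ (combine q (suc r))

    coprimeResidue : Fin (p ^ a ℕ.* p₁) → ℤ
    coprimeResidue i = uncurry digitsResidue (remQuot {p ^ a} p₁ i)

    digitsResidue-p∤ : ∀ q r → ¬ + p ∣ digitsResidue q r
    digitsResidue-p∤ q r p∣ = p∤p*q+suc (toℕ q) r (subst (+ p ∣_) (cong +_ (Fin.toℕ-combine q (suc r))) p∣)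

    coprimeResidue-p∤ : ∀ i → ¬ + p ∣ coprimeResidue i
    coprimeResidue-p∤ i = uncurry digitsResidue-p∤ (remQuot {p ^ a} p₁ i)

    digitsResidue-injective : ∀ q r q′ r′ → digitsResidue q r ≡[ N ] digitsResidue q′ r′ → (q , r) ≡ (q′ , r′)
    digitsResidue-injective q r q′ r′ qr≡q′r′
      with refl , refl ← Fin.combine-injective q (suc r) q′ (suc r′)
                           (Fin.toℕ-injective (<-≡-mod⇒≡ (combine<N _) (combine<N _) qr≡q′r′)) = refl

    coprimeResidue-injective : ∀ i j → coprimeResidue i ≡[ N ] coprimeResidue j → i ≡ j
    coprimeResidue-injective i j i≡j = remQuot-injective p₁ i j
      (digitsResidue-injective (proj₁ (remQuot {p ^ a} p₁ i)) (proj₂ (remQuot {p ^ a} p₁ i))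
                               (proj₁ (remQuot {p ^ a} p₁ j)) (proj₂ (remQuot {p ^ a} p₁ j)) i≡j)

    digitsOf : ∀ z → ∃ λ (c : Fin (p ^ a ℕ.* p)) → + toℕ c ≡[ N ] z
    digitsOf z with c , c≡z ← residue (p ^ a ℕ.* p) {{ℕ.m*n≢0 (p ^ a) p {{ℕ.m^n≢0 p a}}}} z =
      c , subst (λ M → + toℕ c ≡[ M ] z) (ℕ.*-comm (p ^ a) p) c≡z

    coprimeResidue-surjective : ∀ z → ¬ + p ∣ z → ∃ λ i → coprimeResidue i ≡[ N ] z
    coprimeResidue-surjective z p∤z with c , c≡z ← digitsOf z with remQuot {p ^ a} p c in qs≡
    ... | q , zero = ⊥-elim (p∤z (∣-resp-≡-mod (≡-mod-∣ (ℕ.m∣m*n (p ^ a)) c≡z) p∣c))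
      where
      p∣c : + p ∣ + toℕ c
      p∣c = ∣ᵤ⇒∣ (subst (p ℕ.∣_) p*q≡c (ℕ.m∣m*n (toℕ q)))
        where
        p*q≡c : p ℕ.* toℕ q ≡ toℕ c
        p*q≡c = begin
          p ℕ.* toℕ q                                  ≡⟨ ℕ.+-identityʳ _ ⟨
          p ℕ.* toℕ q ℕ.+ 0                            ≡⟨ Fin.toℕ-combine q zero ⟨
          toℕ (uncurry combine (q , zero))             ≡⟨ cong (toℕ ∘ uncurry combine) qs≡ ⟨
          toℕ (uncurry combine (remQuot {p ^ a} p c))  ≡⟨ cong toℕ (Fin.combine-remQuot {p ^ a} p c) ⟩
          toℕ c                                        ∎
          where open ≡-Reasoning
    ... | q , suc r = combine q r , (begin
      coprimeResidue (combine q r)                    ≡⟨ cong (uncurry digitsResidue) (Fin.remQuot-combine q r) ⟩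
      + toℕ (uncurry combine (q , suc r))             ≡⟨ cong (+_ ∘ toℕ ∘ uncurry combine) qs≡ ⟨
      + toℕ (uncurry combine (remQuot {p ^ a} p c))   ≡⟨ cong (+_ ∘ toℕ) (Fin.combine-remQuot {p ^ a} p c) ⟩
      + toℕ c                                         ≈⟨ c≡z ⟩
      z                                               ∎)
      where open ≡-mod-Reasoning N

module ClassCounting where
  open import Data.Nat as ℕ using (ℕ)
  open import Data.Fin using (Fin; combine; remQuot)
  import Data.Fin.Properties as Fin
  open import Data.Product using (∃; _,_; uncurry)
  open import Relation.Binary.PropositionalEquality using (_≡_; sym; subst)
  open Residues using (remQuot-injective)

  classCount-product : ∀ {N S m k} (g : Fin m → Fin k → Elt)
    → (∀ i j → S (g i j))
    → (∀ i j i′ j′ → g i j ≈[ N ] g i′ j′ → (i , j) ≡ (i′ , j′))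
    → (∀ Q → S Q → ∃ λ i → ∃ λ j → g i j ≈[ N ] Q)
    → ClassCount N S (m ℕ.* k)
  classCount-product {N} {S} {m} {k} g g∈S g-injective g-surjective = f , f∈S , f-injective , f-surjective
    where
    f : Fin (m ℕ.* k) → Elt
    f ij = uncurry g (remQuot {m} k ij)
    f∈S : ∀ ij → S (f ij)
    f∈S ij = uncurry g∈S (remQuot {m} k ij)
    f-injective : ∀ ij i′j′ → f ij ≈[ N ] f i′j′ → ij ≡ i′j′
    f-injective ij i′j′ fij≈fi′j′ = remQuot-injective k ij i′j′ (g-injective _ _ _ _ fij≈fi′j′)
    f-surjective : ∀ Q → S Q → ∃ λ ij → f ij ≈[ N ] Q
    f-surjective Q Q∈S with i , j , gij≈Q ← g-surjective Q Q∈S =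
      combine i j , subst (λ ij → uncurry g ij ≈[ N ] Q) (sym (Fin.remQuot-combine i j)) gij≈Q

module ElementCongruence where
  open import Data.Nat as ℕ using (ℕ)
  import Data.Nat.Divisibility as ℕ
  open import Data.Integer using (ℤ; +_)
  import Data.Integer.Properties as ℤ
  import Data.Integer.Divisibility as Unsigned
  open import Data.Integer.Divisibility.Signed using (∣⇒∣ᵤ; ∣ᵤ⇒∣)
  open import Data.Product using (_×_; _,_; proj₁; proj₂)
  open import Function using (id)
  open import Function.Bundles using (_⇔_; mk⇔)
  open import Relation.Binary.Bundles using (Setoid)
  open import Relation.Binary.PropositionalEquality using (_≡_; refl; subst₂)
  open Congruence

  infix 4 _≋[_]_

  record _≋[_]_ (Q : Elt) (m : ℕ) (R : Elt) : Set where
    constructor _,_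
    field
      ≋₁ : proj₁ Q ≡[ m ] proj₁ R
      ≋₂ : proj₂ Q ≡[ m ] proj₂ R

  open _≋[_]_ public

  ≋⇒≈ : ∀ {N Q R} → Q ≋[ N ] R → Q ≈[ N ] R
  ≋⇒≈ (mod d₁ , mod d₂) = ∣⇒∣ᵤ d₁ , ∣⇒∣ᵤ d₂

  -- Q and R are explicit: they cannot be recovered from the unfolded relation Q ≈[ N ] R.
  ≈⇒≋ : ∀ {N} Q R → Q ≈[ N ] R → Q ≋[ N ] R
  ≈⇒≋ _ _ (d₁ , d₂) = mod (∣ᵤ⇒∣ d₁) , mod (∣ᵤ⇒∣ d₂)

  module _ {m : ℕ} where
    ≋-reflexive : ∀ {Q R} → Q ≡ R → Q ≋[ m ] R
    ≋-reflexive refl = ≡-mod-refl , ≡-mod-refl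

    ≋-refl : ∀ {Q} → Q ≋[ m ] Q
    ≋-refl = ≋-reflexive refl

    ≋-sym : ∀ {Q R} → Q ≋[ m ] R → R ≋[ m ] Q
    ≋-sym (e₁ , e₂) = ≡-mod-sym e₁ , ≡-mod-sym e₂

    ≋-trans : ∀ {Q R T} → Q ≋[ m ] R → R ≋[ m ] T → Q ≋[ m ] T
    ≋-trans (e₁ , e₂) (f₁ , f₂) = ≡-mod-trans e₁ f₁ , ≡-mod-trans e₂ f₂

  pair≈zeroO⇔ : ∀ {N} i j → ((i , j) ≈[ N ] zeroO) ⇔ (+ N Unsigned.∣ i × + N Unsigned.∣ j)
  pair≈zeroO⇔ {N} i j = subst₂ (λ i′ j′ → ((i , j) ≈[ N ] zeroO) ⇔ (+ N Unsigned.∣ i′ × + N Unsigned.∣ j′))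
    (ℤ.+-identityʳ i) (ℤ.+-identityʳ j) (mk⇔ id id)

  ≋-mod-∣ : ∀ {k m Q R} → k ℕ.∣ m → Q ≋[ m ] R → Q ≋[ k ] R
  ≋-mod-∣ k∣m (e₁ , e₂) = ≡-mod-∣ k∣m e₁ , ≡-mod-∣ k∣m e₂

  ≋-setoid : ℕ → Setoid _ _
  ≋-setoid m = record
    { _≈_ = λ Q R → Q ≋[ m ] R
    ; isEquivalence = record { refl = ≋-refl ; sym = ≋-sym ; trans = ≋-trans }
    }

  module ≋-Reasoning (m : ℕ) where
    open import Relation.Binary.Reasoning.Setoid (≋-setoid m) public

module QuadraticOrder (t n : ℤ) where
  open import Data.Nat as ℕ using (ℕ)
  open import Data.Integer using (ℤ; +_; _+_; _-_; _*_; -_; 0ℤ; 1ℤ)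
  open import Data.Integer.Tactic.RingSolver using (solve-∀)
  open import Data.Product using (_,_)
  open import Relation.Binary.PropositionalEquality using (_≡_; cong; cong₂; trans)
  open Congruence
  open ElementCongruence

  infixl 7 _·_

  _·_ : Elt → Elt → Elt
  _·_ = mulO t n

  norm : Elt → ℤ
  norm (c , d) = c * c + t * c * d + n * d * d

  conj : Elt → Elt
  conj (c , d) = (c + t * d , - d)

  ·-comm : ∀ u v → u · v ≡ v · u
  ·-comm (a , b) (c , d) = cong₂ _,_ (first a b c d t n) (second a b c d t n)
    where
    first : ∀ a b c d t n → a * c - b * d * n ≡ c * a - d * b * n
    first = solve-∀
    second : ∀ a b c d t n → a * d + c * b + b * d * t ≡ c * b + a * d + d * b * t
    second = solve-∀

  ·-assoc : ∀ u v w → (u · v) · w ≡ u · (v · w)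
  ·-assoc (a , b) (c , d) (e , f) = cong₂ _,_ (first a b c d e f t n) (second a b c d e f t n)
    where
    first : ∀ a b c d e f t n → (a * c - b * d * n) * e - (a * d + c * b + b * d * t) * f * n
                              ≡ a * (c * e - d * f * n) - b * (c * f + e * d + d * f * t) * n
    first = solve-∀
    second : ∀ a b c d e f t n
      → (a * c - b * d * n) * f + e * (a * d + c * b + b * d * t) + (a * d + c * b + b * d * t) * f * t
        ≡ a * (c * f + e * d + d * f * t) + (c * e - d * f * n) * b + b * (c * f + e * d + d * f * t) * t
    second = solve-∀

  ·-identityˡ : ∀ u → oneO · u ≡ u
  ·-identityˡ (a , b) = cong₂ _,_ (first a b n) (second a b t)
    where
    first : ∀ a b n → + 1 * a - + 0 * b * n ≡ a
    first = solve-∀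
    second : ∀ a b t → + 1 * b + a * + 0 + + 0 * b * t ≡ b
    second = solve-∀

  ·-identityʳ : ∀ u → u · oneO ≡ u
  ·-identityʳ u = trans (·-comm u oneO) (·-identityˡ u)

  ·-conj : ∀ u → u · conj u ≡ (norm u , 0ℤ)
  ·-conj (a , b) = cong₂ _,_ (first a b t n) (second a b t)
    where
    first : ∀ a b t n → a * (a + t * b) - b * - b * n ≡ a * a + t * a * b + n * b * b
    first = solve-∀
    second : ∀ a b t → a * - b + (a + t * b) * b + b * - b * t ≡ 0ℤ
    second = solve-∀

  smul-·ʳ : ∀ k u v → u · smul k v ≡ smul k (u · v)
  smul-·ʳ k (a , b) (c , d) = cong₂ _,_ (first k a b c d n) (second k a b c d t)
    where
    first : ∀ k a b c d n → a * (k * c) - b * (k * d) * n ≡ k * (a * c - b * d * n)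
    first = solve-∀
    second : ∀ k a b c d t → a * (k * d) + k * c * b + b * (k * d) * t ≡ k * (a * d + c * b + b * d * t)
    second = solve-∀

  smul-·ˡ : ∀ k u v → smul k u · v ≡ smul k (u · v)
  smul-·ˡ k u v = trans (·-comm (smul k u) v) (trans (smul-·ʳ k v u) (cong (smul k) (·-comm v u)))

  norm-· : ∀ u v → norm (u · v) ≡ norm u * norm v
  norm-· (a , b) (c , d) = multiplicative a b c d t n
    where
    multiplicative : ∀ a b c d t n →
        (a * c - b * d * n) * (a * c - b * d * n) + t * (a * c - b * d * n) * (a * d + c * b + b * d * t)
          + n * (a * d + c * b + b * d * t) * (a * d + c * b + b * d * t)
        ≡ (a * a + t * a * b + n * b * b) * (c * c + t * c * d + n * d * d)
    multiplicative = solve-∀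

  norm-one : norm oneO ≡ 1ℤ
  norm-one = normalise t n
    where
    normalise : ∀ t n → + 1 * + 1 + t * + 1 * + 0 + n * + 0 * + 0 ≡ 1ℤ
    normalise = solve-∀

  module _ {m : ℕ} where
    ·-cong : ∀ {u u′ v v′} → u ≋[ m ] u′ → v ≋[ m ] v′ → u · v ≋[ m ] u′ · v′
    ·-cong (a , b) (c , d) =
      -‿cong-mod (*-cong-mod a c) (*-congʳ-mod n (*-cong-mod b d)) ,
      +-cong-mod (+-cong-mod (*-cong-mod a d) (*-cong-mod c b)) (*-congʳ-mod t (*-cong-mod b d))

    ·-congˡ : ∀ u {v v′} → v ≋[ m ] v′ → u · v ≋[ m ] u · v′
    ·-congˡ u = ·-cong (≋-refl {Q = u})

    ·-congʳ : ∀ v {u u′} → u ≋[ m ] u′ → u · v ≋[ m ] u′ · v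
    ·-congʳ v u≋u′ = ·-cong u≋u′ (≋-refl {Q = v})

    norm-cong : ∀ {u u′} → u ≋[ m ] u′ → norm u ≡[ m ] norm u′
    norm-cong (a , b) =
      +-cong-mod (+-cong-mod (*-cong-mod a a) (*-cong-mod (*-congˡ-mod t a) b)) (*-cong-mod (*-congˡ-mod n b) b)

module Ramified (p : ℕ) (p-prime : Prime p) (p≢2 : p ≢ 2) (t n : ℤ) (disc≡0 : disc t n ≡[ p ] 0ℤ) where
  open import Data.Nat as ℕ using (suc; _^_)
  import Data.Nat.Divisibility as ℕ
  open import Data.Integer using (+_; _+_; _-_; _*_; -_; 0ℤ; 1ℤ)
  import Data.Integer.Properties as ℤ
  open import Data.Integer.Divisibility.Signed
  open import Data.Integer.Tactic.RingSolver using (solve-∀)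
  open import Data.Product using (∃; _,_; proj₁; proj₂)
  open import Relation.Nullary using (¬_)
  open import Relation.Binary.PropositionalEquality using (_≡_; cong; trans; subst₂)
  open Congruence
  open ElementCongruence
  open PrimeModulus p p-prime
  open QuadraticOrder t n

  p∤2 : ¬ + p ∣ + 2
  p∤2 = odd⇒p∤2 p≢2

  half : ℤ
  half = t * proj₁ (p∤⇒invertible-mod-p p∤2)

  2*half≡t : + 2 * half ≡[ p ] t
  2*half≡t = begin
    + 2 * (t * i)   ≡⟨ swap t i ⟩
    t * (+ 2 * i)   ≈⟨ *-congˡ-mod t (proj₂ (p∤⇒invertible-mod-p p∤2)) ⟩
    t * 1ℤ          ≡⟨ ℤ.*-identityʳ t ⟩
    t               ∎
    where
    open ≡-mod-Reasoning p
    i = proj₁ (p∤⇒invertible-mod-p p∤2)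
    swap : ∀ t i → + 2 * (t * i) ≡ t * (+ 2 * i)
    swap = solve-∀

  4*norm≡square : ∀ c d → + 4 * norm (c , d) ≡[ p ] (+ 2 * (c + half * d)) * (+ 2 * (c + half * d))
  4*norm≡square c d = begin
    + 4 * norm (c , d)                                                   ≡⟨ complete-square c d t n ⟩
    (+ 2 * c + t * d) * (+ 2 * c + t * d) - disc t n * (d * d)           ≈⟨ -‿cong-mod (*-cong-mod 2c+td 2c+td) (*-congʳ-mod (d * d) disc≡0) ⟩
    (+ 2 * c + + 2 * half * d) * (+ 2 * c + + 2 * half * d) - 0ℤ * (d * d) ≡⟨ factor c d half ⟩
    (+ 2 * (c + half * d)) * (+ 2 * (c + half * d))                      ∎
    where
    open ≡-mod-Reasoning p
    2c+td : + 2 * c + t * d ≡[ p ] + 2 * c + + 2 * half * d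
    2c+td = +-congˡ-mod (+ 2 * c) (*-congʳ-mod d (≡-mod-sym 2*half≡t))
    complete-square : ∀ c d t n → + 4 * (c * c + t * c * d + n * d * d)
                                  ≡ (+ 2 * c + t * d) * (+ 2 * c + t * d) - (t * t - + 4 * n) * (d * d)
    complete-square = solve-∀
    factor : ∀ c d h → (+ 2 * c + + 2 * h * d) * (+ 2 * c + + 2 * h * d) - 0ℤ * (d * d)
                       ≡ (+ 2 * (c + h * d)) * (+ 2 * (c + h * d))
    factor = solve-∀

  p∤4 : ¬ + p ∣ + 4
  p∤4 = p∤*p∤⇒p∤* p∤2 p∤2

  p∣norm⇒p∣c+half*d : ∀ c d → + p ∣ norm (c , d) → + p ∣ c + half * d
  p∣norm⇒p∣c+half*d c d p∣norm = p∣*∧p∤⇒p∣ (+ 2) (c + half * d) p∣2r p∤2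
    where
    p∣2r : + p ∣ + 2 * (c + half * d)
    p∣2r = p∣²⇒p∣ _ (∣-resp-≡-mod (4*norm≡square c d) (∣n⇒∣m*n (+ 4) p∣norm))

  p∣c+half*d⇒p∣norm : ∀ c d → + p ∣ c + half * d → + p ∣ norm (c , d)
  p∣c+half*d⇒p∣norm c d p∣r = p∣*∧p∤⇒p∣ (+ 4) (norm (c , d)) p∣4norm p∤4
    where
    p∣4norm : + p ∣ + 4 * norm (c , d)
    p∣4norm = ∣-resp-≡-mod (≡-mod-sym (4*norm≡square c d)) (∣m⇒∣m*n _ (∣n⇒∣m*n (+ 2) p∣r))

  module Units (a : ℕ) where
    N : ℕ
    N = p ^ suc a

    p∣N : p ℕ.∣ N
    p∣N = ℕ.m∣m*n (p ^ a)

    isUnit⇒p∤norm : ∀ u → IsUnit t n N u → ¬ + p ∣ norm u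
    isUnit⇒p∤norm u (v , uv≈1) p∣norm = p∤1 (∣-resp-≡-mod norm-uv≡1 (∣m⇒∣m*n (norm v) p∣norm))
      where
      norm-uv≡1 : norm u * norm v ≡[ p ] 1ℤ
      norm-uv≡1 = subst₂ (λ x y → x ≡[ p ] y) (norm-· u v) norm-one
                    (norm-cong (≋-mod-∣ p∣N (≈⇒≋ (u · v) oneO uv≈1)))

    p∤norm⇒inverse : ∀ u → ¬ + p ∣ norm u → ∃ λ v → u · v ≋[ N ] oneO
    p∤norm⇒inverse u p∤norm = smul k (conj u) , (begin
      u · smul k (conj u)       ≡⟨ trans (smul-·ʳ k u (conj u)) (cong (smul k) (·-conj u)) ⟩
      (k * norm u , k * 0ℤ)     ≈⟨ k*norm≡1 , ≡⇒≡-mod (ℤ.*-zeroʳ k) ⟩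
      oneO                      ∎)
      where
      open ≋-Reasoning N
      k : ℤ
      k = proj₁ (p∤⇒invertible (suc a) p∤norm)
      k*norm≡1 : k * norm u ≡[ N ] 1ℤ
      k*norm≡1 = ≡-mod-trans (≡⇒≡-mod (ℤ.*-comm k (norm u))) (proj₂ (p∤⇒invertible (suc a) p∤norm))

    p∤norm⇒isUnit : ∀ u → ¬ + p ∣ norm u → IsUnit t n N u
    p∤norm⇒isUnit u p∤norm = proj₁ (p∤norm⇒inverse u p∤norm) , ≋⇒≈ (proj₂ (p∤norm⇒inverse u p∤norm))

    isUnit⇒p∤c+half*d : ∀ c d → IsUnit t n N (c , d) → ¬ + p ∣ c + half * d
    isUnit⇒p∤c+half*d c d unit p∣r = isUnit⇒p∤norm (c , d) unit (p∣c+half*d⇒p∣norm c d p∣r)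

    p∤c+half*d⇒isUnit : ∀ c d → ¬ + p ∣ c + half * d → IsUnit t n N (c , d)
    p∤c+half*d⇒isUnit c d p∤r = p∤norm⇒isUnit (c , d) (λ p∣norm → p∤r (p∣norm⇒p∣c+half*d c d p∣norm))

module PointOfFullOrder (p₁ : ℕ) (p-prime : Prime (suc p₁)) (p≢2 : suc p₁ ≢ 2) (t n : ℤ) (disc≡0 : disc t n ≡[ suc p₁ ] 0ℤ)
             (a : ℕ) (P : Elt) (order : HasAddOrder (suc p₁ ^ suc a) P (suc p₁ ^ suc a)) where
  -- The exponent a of the statement is suc a here, so its count p^(a + b − 1)·(p − 1) reads p^(a + b)·p₁.
  open import Data.Nat as ℕ using (suc; _^_; _≤_)
  import Data.Nat.Properties as ℕ
  open import Data.Fin using (Fin; toℕ)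
  open import Data.Integer using (+_; _+_; _-_; _*_; -_; 0ℤ; 1ℤ)
  import Data.Integer.Properties as ℤ
  import Data.Integer.Divisibility as Unsigned
  open import Data.Integer.Divisibility.Signed
  open import Data.Integer.Tactic.RingSolver using (solve-∀)
  open import Data.Product using (Σ; ∃; _×_; _,_; proj₁; proj₂)
  open import Data.Product.Properties using (×-≡,≡→≡)
  open import Function.Bundles using (_⇔_; mk⇔)
  open import Relation.Nullary using (¬_; Dec; yes; no)
  open import Relation.Binary.PropositionalEquality using (_≡_; refl; cong; cong₂; sym; trans; subst; module ≡-Reasoning)
  open import Data.Nat.Primality using (prime⇒nonTrivial)
  open Congruence
  open ElementCongruence
  open PrimeModulus (suc p₁) p-prime
  open QuadraticOrder t n
  open Ramified (suc p₁) p-prime p≢2 t n disc≡0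
  open Units a
  open Residues
  open PrimeTo p₁ a using (p; coprimeResidue; coprimeResidue-p∤; coprimeResidue-injective; coprimeResidue-surjective)
  open ClassCounting

  instance
    N≢0 : ℕ.NonZero N
    N≢0 = ℕ.m^n≢0 p (suc a)

  Conclusion : Set
  Conclusion = Σ ℕ λ b → b ≤ suc a
    × IsoCyc² N (InM t n N P) N (p ^ b)
    × ClassCount N (InOrbit t n N P) (p ^ (a ℕ.+ b) ℕ.* p₁)

  orbitCount : ∀ {b} (g : Fin (p ^ a ℕ.* p₁) → Fin (p ^ b) → Elt)
    → (∀ i j → InOrbit t n N P (g i j))
    → (∀ i j i′ j′ → g i j ≈[ N ] g i′ j′ → (i , j) ≡ (i′ , j′))
    → (∀ Q → InOrbit t n N P Q → ∃ λ i → ∃ λ j → g i j ≈[ N ] Q)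
    → ClassCount N (InOrbit t n N P) (p ^ (a ℕ.+ b) ℕ.* p₁)
  orbitCount {b} g g∈ g-inj g-surj = subst (ClassCount N (InOrbit t n N P)) count≡ (classCount-product g g∈ g-inj g-surj)
    where
    count≡ : p ^ a ℕ.* p₁ ℕ.* p ^ b ≡ p ^ (a ℕ.+ b) ℕ.* p₁
    count≡ = begin
      p ^ a ℕ.* p₁ ℕ.* p ^ b     ≡⟨ ℕ.*-assoc (p ^ a) p₁ (p ^ b) ⟩
      p ^ a ℕ.* (p₁ ℕ.* p ^ b)   ≡⟨ cong (p ^ a ℕ.*_) (ℕ.*-comm p₁ (p ^ b)) ⟩
      p ^ a ℕ.* (p ^ b ℕ.* p₁)   ≡⟨ ℕ.*-assoc (p ^ a) (p ^ b) p₁ ⟨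
      p ^ a ℕ.* p ^ b ℕ.* p₁     ≡⟨ cong (ℕ._* p₁) (ℕ.^-distribˡ-+-* p a b) ⟨
      p ^ (a ℕ.+ b) ℕ.* p₁       ∎
      where open ≡-Reasoning

  x y : ℤ
  x = proj₁ P
  y = proj₂ P

  p∣x⇒p∤y : + p ∣ x → ¬ + p ∣ y
  p∣x⇒p∤y (divides kx x≡kxp) (divides ky y≡kyp) =
    proj₂ (proj₂ order) (p ^ a) (ℕ.m^n>0 p a) pᵃ<N (≋⇒≈ (pᵃ*≡0 x kx x≡kxp , pᵃ*≡0 y ky y≡kyp))
    where
    pᵃ<N : p ^ a ℕ.< N
    pᵃ<N = subst (p ^ a ℕ.<_) (ℕ.*-comm (p ^ a) p)
             (ℕ.m<m*n (p ^ a) p {{ℕ.m^n≢0 p a}} (ℕ.nonTrivial⇒n>1 p {{prime⇒nonTrivial p-prime}}))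
    pᵃ*≡0 : ∀ z k → z ≡ k * + p → + (p ^ a) * z ≡[ N ] 0ℤ
    pᵃ*≡0 z k refl =
      ∣⇒≡0-mod (divides k (trans (regroup (+ (p ^ a)) k (+ p)) (cong (k *_) (sym (ℤ.pos-* p (p ^ a))))))
      where
      regroup : ∀ u k v → u * (k * v) ≡ k * (v * u)
      regroup = solve-∀

  ω : Elt
  ω = (0ℤ , 1ℤ)

  module Invertible (p∤norm : ¬ + p ∣ norm P) where
    P⁻¹ : Elt
    P⁻¹ = proj₁ (p∤norm⇒inverse P p∤norm)

    P·P⁻¹≋1 : P · P⁻¹ ≋[ N ] oneO
    P·P⁻¹≋1 = proj₂ (p∤norm⇒inverse P p∤norm)

    ·P-cancel : ∀ {u v} → u · P ≋[ N ] v · P → u ≋[ N ] v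
    ·P-cancel {u} {v} uP≋vP = begin
      u               ≡⟨ ·-identityʳ u ⟨
      u · oneO        ≈⟨ ·-congˡ u P·P⁻¹≋1 ⟨
      u · (P · P⁻¹)   ≡⟨ ·-assoc u P P⁻¹ ⟨
      u · P · P⁻¹     ≈⟨ ·-congʳ P⁻¹ uP≋vP ⟩
      v · P · P⁻¹     ≡⟨ ·-assoc v P P⁻¹ ⟩
      v · (P · P⁻¹)   ≈⟨ ·-congˡ v P·P⁻¹≋1 ⟩
      v · oneO        ≡⟨ ·-identityʳ v ⟩
      v               ∎
      where open ≋-Reasoning N

    ∈M : ∀ Q → InM t n N P Q
    ∈M Q = Q · P⁻¹ , ≋⇒≈ (begin
      Q · P⁻¹ · P     ≡⟨ trans (·-assoc Q P⁻¹ P) (cong (Q ·_) (·-comm P⁻¹ P)) ⟩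
      Q · (P · P⁻¹)   ≈⟨ ·-congˡ Q P·P⁻¹≋1 ⟩
      Q · oneO        ≡⟨ ·-identityʳ Q ⟩
      Q               ∎)
      where open ≋-Reasoning N

    basis : ∀ i j → addO (smul i oneO) (smul j ω) ≡ (i , j)
    basis i j = cong₂ _,_ (first i j) (second i j)
      where
      first : ∀ i j → i * + 1 + j * + 0 ≡ i
      first = solve-∀
      second : ∀ i j → i * + 0 + j * + 1 ≡ j
      second = solve-∀

    kernel : ∀ i j → (addO (smul i oneO) (smul j ω) ≈[ N ] zeroO) ⇔ (+ N Unsigned.∣ i × + N Unsigned.∣ j)
    kernel i j = subst (λ Q → (Q ≈[ N ] zeroO) ⇔ (+ N Unsigned.∣ i × + N Unsigned.∣ j)) (sym (basis i j))
      (pair≈zeroO⇔ i j)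

    M-iso : IsoCyc² N (InM t n N P) N (p ^ suc a)
    M-iso = oneO , ω , ∈M oneO , ∈M ω , kernel ,
      λ Q _ → proj₁ Q , proj₂ Q , ≋⇒≈ (≋-reflexive (basis (proj₁ Q) (proj₂ Q)))

    unitAt : Fin (p ^ a ℕ.* p₁) → Fin N → Elt
    unitAt i j = (coprimeResidue i - half * + toℕ j , + toℕ j)

    shift : ∀ u v → u - half * v + half * v ≡ u
    shift u v = cancel u half v
      where
      cancel : ∀ u h v → u - h * v + h * v ≡ u
      cancel = solve-∀

    unitAt-isUnit : ∀ i j → IsUnit t n N (unitAt i j)
    unitAt-isUnit i j = p∤c+half*d⇒isUnit (coprimeResidue i - half * + toℕ j) (+ toℕ j)
      (subst (λ z → ¬ + p ∣ z) (sym (shift (coprimeResidue i) (+ toℕ j))) (coprimeResidue-p∤ i))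

    unitAt-injective : ∀ i j i′ j′ → unitAt i j ≋[ N ] unitAt i′ j′ → (i , j) ≡ (i′ , j′)
    unitAt-injective i j i′ j′ (c≡c′ , d≡d′) =
      ×-≡,≡→≡ (coprimeResidue-injective i i′ u≡u′ , toℕ-≡-mod-injective j j′ d≡d′)
      where
      u≡u′ : coprimeResidue i ≡[ N ] coprimeResidue i′
      u≡u′ = begin
        coprimeResidue i                                   ≡⟨ shift _ _ ⟨
        proj₁ (unitAt i j) + half * + toℕ j                ≈⟨ +-cong-mod c≡c′ (*-congˡ-mod half d≡d′) ⟩
        proj₁ (unitAt i′ j′) + half * + toℕ j′             ≡⟨ shift _ _ ⟩
        coprimeResidue i′                                  ∎
        where open ≡-mod-Reasoning N

    orbit-count : ClassCount N (InOrbit t n N P) (p ^ (a ℕ.+ suc a) ℕ.* p₁)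
    orbit-count = orbitCount (λ i j → unitAt i j · P)
      (λ i j → unitAt i j , unitAt-isUnit i j , ≋⇒≈ (≋-refl {Q = unitAt i j · P}))
      (λ i j i′ j′ e → unitAt-injective i j i′ j′ (·P-cancel (≈⇒≋ (unitAt i j · P) (unitAt i′ j′ · P) e)))
      surjective
      where
      surjective : ∀ Q → InOrbit t n N P Q → ∃ λ i → ∃ λ j → (unitAt i j · P) ≈[ N ] Q
      surjective Q ((c , d) , unit , cdP≈Q) = i , j , ≋⇒≈ (≋-trans (·-congʳ P unitAt≋cd) (≈⇒≋ ((c , d) · P) Q cdP≈Q))
        where
        i = proj₁ (coprimeResidue-surjective (c + half * d) (isUnit⇒p∤c+half*d c d unit))
        uᵢ≡c+hd = proj₂ (coprimeResidue-surjective (c + half * d) (isUnit⇒p∤c+half*d c d unit))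
        j = proj₁ (residue N d)
        j≡d = proj₂ (residue N d)
        unitAt≋cd : unitAt i j ≋[ N ] (c , d)
        unitAt≋cd = (begin
          coprimeResidue i - half * + toℕ j   ≈⟨ -‿cong-mod uᵢ≡c+hd (*-congˡ-mod half j≡d) ⟩
          c + half * d - half * d             ≡⟨ unshift c half d ⟩
          c                                   ∎) , j≡d
          where
          open ≡-mod-Reasoning N
          unshift : ∀ c h d → c + h * d - h * d ≡ c
          unshift = solve-∀

    conclusion : Conclusion
    conclusion = suc a , ℕ.≤-refl , M-iso , orbit-count

  module NonInvertible (p∣norm : + p ∣ norm P) where
    p∤y : ¬ + p ∣ y
    p∤y p∣y = p∣x⇒p∤y (p∣²⇒p∣ x p∣x²) p∣y
      where
      x²≡ : ∀ x y t n → x * x ≡ (x * x + t * x * y + n * y * y) - y * (t * x + n * y)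
      x²≡ = solve-∀
      p∣x² : + p ∣ x * x
      p∣x² = subst (+ p ∣_) (sym (x²≡ x y t n)) (∣m∣n⇒∣m-n p∣norm (∣m⇒∣m*n (t * x + n * y) p∣y))

    y⁻¹ : ℤ
    y⁻¹ = proj₁ (p∤⇒invertible (suc a) p∤y)

    y*y⁻¹≡1 : y * y⁻¹ ≡[ N ] 1ℤ
    y*y⁻¹≡1 = proj₂ (p∤⇒invertible (suc a) p∤y)

    -- c₀ is chosen so that (ω − c₀)·P is congruent to the integer w modulo N.
    c₀ : ℤ
    c₀ = (x + t * y) * y⁻¹

    c₀≡half : c₀ ≡[ p ] half
    c₀≡half = begin
      (x + t * y) * y⁻¹                               ≡⟨ regroup x y t y⁻¹ half ⟩
      (x + half * y) * y⁻¹ + (t - half) * (y * y⁻¹)   ≈⟨ +-cong-mod x+half*y≡0 t-half≡half ⟩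
      0ℤ * y⁻¹ + half * 1ℤ                            ≡⟨ simplify y⁻¹ half ⟩
      half                                            ∎
      where
      open ≡-mod-Reasoning p
      regroup : ∀ x y t y⁻¹ h → (x + t * y) * y⁻¹ ≡ (x + h * y) * y⁻¹ + (t - h) * (y * y⁻¹)
      regroup = solve-∀
      simplify : ∀ y⁻¹ h → 0ℤ * y⁻¹ + h * 1ℤ ≡ h
      simplify = solve-∀
      x+half*y≡0 : (x + half * y) * y⁻¹ ≡[ p ] 0ℤ * y⁻¹
      x+half*y≡0 = *-congʳ-mod y⁻¹ (∣⇒≡0-mod (p∣norm⇒p∣c+half*d x y p∣norm))
      t-half≡half : (t - half) * (y * y⁻¹) ≡[ p ] half * 1ℤ
      t-half≡half = *-cong-mod (≡-mod-trans (-‿cong-mod (≡-mod-sym 2*half≡t) (≡-mod-refl {x = half}))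
                                            (≡⇒≡-mod (twice-minus half)))
                               (≡-mod-∣ p∣N y*y⁻¹≡1)
        where
        twice-minus : ∀ h → + 2 * h - h ≡ h
        twice-minus = solve-∀

    c+d*c₀≡c+half*d : ∀ c d → c + d * c₀ ≡[ p ] c + half * d
    c+d*c₀≡c+half*d c d = +-congˡ-mod c (≡-mod-trans (*-congˡ-mod d c₀≡half) (≡⇒≡-mod (ℤ.*-comm d half)))

    p∤c+d*c₀⇒isUnit : ∀ c d → ¬ + p ∣ c + d * c₀ → IsUnit t n N (c , d)
    p∤c+d*c₀⇒isUnit c d p∤ = p∤c+half*d⇒isUnit c d (λ p∣ → p∤ (∣-resp-≡-mod (≡-mod-sym (c+d*c₀≡c+half*d c d)) p∣))

    isUnit⇒p∤c+d*c₀ : ∀ c d → IsUnit t n N (c , d) → ¬ + p ∣ c + d * c₀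
    isUnit⇒p∤c+d*c₀ c d unit p∣ = isUnit⇒p∤c+half*d c d unit (∣-resp-≡-mod (c+d*c₀≡c+half*d c d) p∣)

    w : ℤ
    w = proj₁ ((- c₀ , 1ℤ) · P)

    ω-c₀-coordinate≡0 : proj₂ ((- c₀ , 1ℤ) · P) ≡[ N ] 0ℤ
    ω-c₀-coordinate≡0 = begin
      - c₀ * y + x * 1ℤ + 1ℤ * y * t   ≡⟨ factor x y t y⁻¹ ⟩
      (x + t * y) * (1ℤ - y * y⁻¹)     ≈⟨ *-congˡ-mod (x + t * y) (-‿cong-mod (≡-mod-refl {x = 1ℤ}) y*y⁻¹≡1) ⟩
      (x + t * y) * (1ℤ - 1ℤ)          ≡⟨ ℤ.*-zeroʳ (x + t * y) ⟩
      0ℤ                               ∎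
      where
      open ≡-mod-Reasoning N
      factor : ∀ x y t y⁻¹ → - ((x + t * y) * y⁻¹) * y + x * 1ℤ + 1ℤ * y * t ≡ (x + t * y) * (1ℤ - y * y⁻¹)
      factor = solve-∀

    module Valuation (e : ℕ) (e≤1+a : e ≤ suc a) (q : ℤ) (w≡q*pᵉ : w ≡ q * + (p ^ e))
                      (κ : ℤ) (q*κ≡1 : q * κ ≡[ p ^ (suc a ℕ.∸ e) ] 1ℤ) where
      b : ℕ
      b = suc a ℕ.∸ e

      pᵉ : ℤ
      pᵉ = + (p ^ e)

      instance
        pᵉ≢0 : ℕ.NonZero (p ^ e)
        pᵉ≢0 = ℕ.m^n≢0 p e
        pᵇ≢0 : ℕ.NonZero (p ^ b)
        pᵇ≢0 = ℕ.m^n≢0 p b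

      pᵇ*pᵉ≡N : p ^ b ℕ.* p ^ e ≡ N
      pᵇ*pᵉ≡N = trans (sym (ℕ.^-distribˡ-+-* p b e)) (cong (p ^_) (ℕ.m∸n+n≡m e≤1+a))

      scale : ∀ {j j′} → j ≡[ p ^ b ] j′ → j * pᵉ ≡[ N ] j′ * pᵉ
      scale {j} {j′} j≡j′ = subst (λ M → j * pᵉ ≡[ M ] j′ * pᵉ) pᵇ*pᵉ≡N (*-scale-mod (p ^ e) j≡j′)

      unscale : ∀ {j j′} → j * pᵉ ≡[ N ] j′ * pᵉ → j ≡[ p ^ b ] j′
      unscale {j} {j′} jpᵉ≡j′pᵉ =
        *-unscale-mod (p ^ e) (subst (λ M → j * pᵉ ≡[ M ] j′ * pᵉ) (sym pᵇ*pᵉ≡N) jpᵉ≡j′pᵉ)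

      g₂ : Elt
      g₂ = (pᵉ , 0ℤ)

      A : ℤ → ℤ → Elt
      A i j = addO (smul i P) (smul j g₂)

      A-cong : ∀ {i i′ j j′} → i ≡[ N ] i′ → j ≡[ p ^ b ] j′ → A i j ≋[ N ] A i′ j′
      A-cong {i} {i′} {j} {j′} i≡i′ j≡j′ =
        +-cong-mod (*-congʳ-mod x i≡i′) (scale j≡j′) ,
        +-cong-mod (*-congʳ-mod y i≡i′) (≡⇒≡-mod (trans (ℤ.*-zeroʳ j) (sym (ℤ.*-zeroʳ j′))))

      A≋0⇒≡0 : ∀ i j → A i j ≋[ N ] zeroO → i ≡[ N ] 0ℤ × j ≡[ p ^ b ] 0ℤ
      A≋0⇒≡0 i j (first≡0 , second≡0) = i≡0 , unscale jpᵉ≡0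
        where
        open ≡-mod-Reasoning N
        i≡0 : i ≡[ N ] 0ℤ
        i≡0 = begin
          i                       ≡⟨ ℤ.*-identityʳ i ⟨
          i * 1ℤ                  ≈⟨ *-congˡ-mod i y*y⁻¹≡1 ⟨
          i * (y * y⁻¹)           ≡⟨ ℤ.*-assoc i y y⁻¹ ⟨
          i * y * y⁻¹             ≡⟨ cong (_* y⁻¹) (ℤ.+-identityʳ (i * y)) ⟨
          (i * y + 0ℤ) * y⁻¹      ≡⟨ cong (λ z → (i * y + z) * y⁻¹) (ℤ.*-zeroʳ j) ⟨
          (i * y + j * 0ℤ) * y⁻¹  ≈⟨ *-congʳ-mod y⁻¹ second≡0 ⟩
          0ℤ * y⁻¹                ≡⟨ ℤ.*-zeroˡ y⁻¹ ⟩
          0ℤ                      ∎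
        jpᵉ≡0 : j * pᵉ ≡[ N ] 0ℤ * pᵉ
        jpᵉ≡0 = begin
          j * pᵉ                        ≡⟨ isolate i x j pᵉ ⟩
          (i * x + j * pᵉ) - i * x      ≈⟨ -‿cong-mod first≡0 (*-congʳ-mod x i≡0) ⟩
          0ℤ - 0ℤ * x                   ≡⟨ ℤ.*-zeroˡ pᵉ ⟨
          0ℤ * pᵉ                       ∎
          where
          isolate : ∀ i x j pᵉ → j * pᵉ ≡ (i * x + j * pᵉ) - i * x
          isolate = solve-∀

      0≡0⇒A≋0 : ∀ {i j} → i ≡[ N ] 0ℤ → j ≡[ p ^ b ] 0ℤ → A i j ≋[ N ] zeroO
      0≡0⇒A≋0 i≡0 j≡0 = A-cong i≡0 j≡0

      A-difference : ∀ i j i′ j′ → A i j ≋[ N ] A i′ j′ → A (i - i′) (j - j′) ≋[ N ] zeroO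
      A-difference i j i′ j′ (first≡ , second≡) =
        ≡-mod-trans (≡⇒≡-mod (linear i i′ x j j′ pᵉ)) (≡-mod⇒-≡0 first≡) ,
        ≡-mod-trans (≡⇒≡-mod (linear i i′ y j j′ 0ℤ)) (≡-mod⇒-≡0 second≡)
        where
        linear : ∀ i i′ x j j′ v → (i - i′) * x + (j - j′) * v ≡ (i * x + j * v) - (i′ * x + j′ * v)
        linear = solve-∀

      ·P≋A : ∀ c d → (c , d) · P ≋[ N ] A (c + d * c₀) (d * q)
      ·P≋A c d = ≡⇒≡-mod first , second
        where
        first : c * x - d * y * n ≡ (c + d * c₀) * x + d * q * pᵉ
        first = begin
          c * x - d * y * n                                    ≡⟨ split-first c d c₀ x y n ⟩
          (c + d * c₀) * x + d * (- c₀ * x - 1ℤ * y * n)       ≡⟨ cong (λ z → (c + d * c₀) * x + d * z) w≡q*pᵉ ⟩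
          (c + d * c₀) * x + d * (q * pᵉ)                      ≡⟨ cong (λ z → (c + d * c₀) * x + z) (ℤ.*-assoc d q pᵉ) ⟨
          (c + d * c₀) * x + d * q * pᵉ                        ∎
          where
          open ≡-Reasoning
          split-first : ∀ c d c₀ x y n → c * x - d * y * n ≡ (c + d * c₀) * x + d * (- c₀ * x - 1ℤ * y * n)
          split-first = solve-∀
        second : c * y + x * d + d * y * t ≡[ N ] (c + d * c₀) * y + d * q * 0ℤ
        second = begin
          c * y + x * d + d * y * t                              ≡⟨ split-second c d c₀ x y t ⟩
          (c + d * c₀) * y + d * (- c₀ * y + x * 1ℤ + 1ℤ * y * t) ≈⟨ +-congˡ-mod ((c + d * c₀) * y) (*-congˡ-mod d ω-c₀-coordinate≡0) ⟩
          (c + d * c₀) * y + d * 0ℤ                              ≡⟨ cong (λ z → (c + d * c₀) * y + z) d*0≡d*q*0 ⟩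
          (c + d * c₀) * y + d * q * 0ℤ                          ∎
          where
          open ≡-mod-Reasoning N
          d*0≡d*q*0 : d * 0ℤ ≡ d * q * 0ℤ
          d*0≡d*q*0 = trans (ℤ.*-zeroʳ d) (sym (ℤ.*-zeroʳ (d * q)))
          split-second : ∀ c d c₀ x y t → c * y + x * d + d * y * t ≡ (c + d * c₀) * y + d * (- c₀ * y + x * 1ℤ + 1ℤ * y * t)
          split-second = solve-∀

      κ*w≡pᵉ : κ * w ≡[ N ] pᵉ
      κ*w≡pᵉ = begin
        κ * w              ≡⟨ cong (κ *_) w≡q*pᵉ ⟩
        κ * (q * pᵉ)       ≡⟨ regroup κ q pᵉ ⟩
        q * κ * pᵉ         ≈⟨ scale q*κ≡1 ⟩
        1ℤ * pᵉ            ≡⟨ ℤ.*-identityˡ pᵉ ⟩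
        pᵉ                 ∎
        where
        open ≡-mod-Reasoning N
        regroup : ∀ κ q v → κ * (q * v) ≡ q * κ * v
        regroup = solve-∀

      g₂∈M : InM t n N P g₂
      g₂∈M = smul κ (- c₀ , 1ℤ) , ≋⇒≈ (begin
        smul κ (- c₀ , 1ℤ) · P          ≡⟨ smul-·ˡ κ (- c₀ , 1ℤ) P ⟩
        smul κ ((- c₀ , 1ℤ) · P)        ≈⟨ κ*w≡pᵉ , ≡-mod-trans (*-congˡ-mod κ ω-c₀-coordinate≡0) (≡⇒≡-mod (ℤ.*-zeroʳ κ)) ⟩
        g₂                              ∎)
        where open ≋-Reasoning N

      M-iso : IsoCyc² N (InM t n N P) N (p ^ b)
      M-iso = P , g₂ , (oneO , ≋⇒≈ (≋-reflexive (·-identityˡ P))) , g₂∈M , kernel , surjective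
        where
        kernel : ∀ i j → (A i j ≈[ N ] zeroO) ⇔ (+ N Unsigned.∣ i × + (p ^ b) Unsigned.∣ j)
        kernel i j = mk⇔
          (λ A≈0 → let (i≡0 , j≡0) = A≋0⇒≡0 i j (≈⇒≋ (A i j) zeroO A≈0)
                   in ∣⇒∣ᵤ (≡0-mod⇒∣ i≡0) , ∣⇒∣ᵤ (≡0-mod⇒∣ j≡0))
          (λ (N∣i , pᵇ∣j) → ≋⇒≈ (0≡0⇒A≋0 {i} {j} (∣⇒≡0-mod (∣ᵤ⇒∣ N∣i)) (∣⇒≡0-mod (∣ᵤ⇒∣ pᵇ∣j))))
        surjective : ∀ Q → InM t n N P Q → ∃ λ i → ∃ λ j → A i j ≈[ N ] Q
        surjective Q ((c , d) , cdP≈Q) =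
          c + d * c₀ , d * q , ≋⇒≈ (≋-trans (≋-sym (·P≋A c d)) (≈⇒≋ ((c , d) · P) Q cdP≈Q))

      orbitPoint : Fin (p ^ a ℕ.* p₁) → Fin (p ^ b) → Elt
      orbitPoint i j = A (coprimeResidue i) (+ toℕ j)

      orbitPoint∈orbit : ∀ i j → InOrbit t n N P (orbitPoint i j)
      orbitPoint∈orbit i j =
        (c , d) , p∤c+d*c₀⇒isUnit c d p∤c+d*c₀ , ≋⇒≈ (≋-trans (·P≋A c d) (A-cong c+d*c₀≡u d*q≡j))
        where
        d c : ℤ
        d = + toℕ j * κ
        c = coprimeResidue i - d * c₀
        c+d*c₀≡u : c + d * c₀ ≡[ N ] coprimeResidue i
        c+d*c₀≡u = ≡⇒≡-mod (cancel (coprimeResidue i) (d * c₀))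
          where
          cancel : ∀ u v → u - v + v ≡ u
          cancel = solve-∀
        p∤c+d*c₀ : ¬ + p ∣ c + d * c₀
        p∤c+d*c₀ p∣ = coprimeResidue-p∤ i (∣-resp-≡-mod (≡-mod-∣ p∣N c+d*c₀≡u) p∣)
        d*q≡j : d * q ≡[ p ^ b ] + toℕ j
        d*q≡j = begin
          + toℕ j * κ * q        ≡⟨ regroup (+ toℕ j) κ q ⟩
          + toℕ j * (q * κ)      ≈⟨ *-congˡ-mod (+ toℕ j) q*κ≡1 ⟩
          + toℕ j * 1ℤ           ≡⟨ ℤ.*-identityʳ (+ toℕ j) ⟩
          + toℕ j                ∎
          where
          open ≡-mod-Reasoning (p ^ b)
          regroup : ∀ j κ q → j * κ * q ≡ j * (q * κ)
          regroup = solve-∀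

      orbitPoint-injective : ∀ i j i′ j′ → orbitPoint i j ≋[ N ] orbitPoint i′ j′ → (i , j) ≡ (i′ , j′)
      orbitPoint-injective i j i′ j′ Aij≋Ai′j′ =
        ×-≡,≡→≡ (coprimeResidue-injective i i′ (-≡0⇒≡-mod {a = coprimeResidue i} {b = coprimeResidue i′} (proj₁ difference≡0)) ,
                 toℕ-≡-mod-injective j j′ (-≡0⇒≡-mod {a = + toℕ j} {b = + toℕ j′} (proj₂ difference≡0)))
        where
        difference≡0 : coprimeResidue i - coprimeResidue i′ ≡[ N ] 0ℤ × + toℕ j - + toℕ j′ ≡[ p ^ b ] 0ℤ
        difference≡0 = A≋0⇒≡0 (coprimeResidue i - coprimeResidue i′) (+ toℕ j - + toℕ j′)
          (A-difference (coprimeResidue i) (+ toℕ j) (coprimeResidue i′) (+ toℕ j′) Aij≋Ai′j′)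

      orbitPoint-surjective : ∀ Q → InOrbit t n N P Q → ∃ λ i → ∃ λ j → orbitPoint i j ≈[ N ] Q
      orbitPoint-surjective Q ((c , d) , unit , cdP≈Q) =
        i , j , ≋⇒≈ (≋-trans (A-cong uᵢ≡c+d*c₀ j≡d*q) (≋-trans (≋-sym (·P≋A c d)) (≈⇒≋ ((c , d) · P) Q cdP≈Q)))
        where
        i = proj₁ (coprimeResidue-surjective (c + d * c₀) (isUnit⇒p∤c+d*c₀ c d unit))
        uᵢ≡c+d*c₀ = proj₂ (coprimeResidue-surjective (c + d * c₀) (isUnit⇒p∤c+d*c₀ c d unit))
        j = proj₁ (residue (p ^ b) (d * q))
        j≡d*q = proj₂ (residue (p ^ b) (d * q))

      conclusion : Conclusion
      conclusion = b , ℕ.m∸n≤m (suc a) e , M-iso ,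
        orbitCount orbitPoint orbitPoint∈orbit
          (λ i j i′ j′ e → orbitPoint-injective i j i′ j′ (≈⇒≋ (orbitPoint i j) (orbitPoint i′ j′) e))
          orbitPoint-surjective

    conclusion : Conclusion
    conclusion =
      let (e , e≤1+a , q , w≡q*pᵉ , κ , q*κ≡1) = valuation-decomposition w (suc a)
      in Valuation.conclusion e e≤1+a q w≡q*pᵉ κ q*κ≡1

  conclusion : Conclusion
  conclusion = by-cases (+ p ∣? norm P)
    where
    by-cases : Dec (+ p ∣ norm P) → Conclusion
    by-cases (yes p∣norm) = NonInvertible.conclusion p∣norm
    by-cases (no p∤norm) = Invertible.conclusion p∤norm

open import Data.Nat using (ℕ; zero; _≤_; _^_; _*_; _+_; _∸_)
open import Relation.Binary.PropositionalEquality using (_≢_)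
open import Data.Nat.Primality using (Prime; ¬prime[0])
open import Data.Integer using (ℤ; _<_; +_; 0ℤ)
open import Data.Integer.Divisibility using (_∣_)
open import Data.Integer.Divisibility.Signed using (∣ᵤ⇒∣)
open import Data.Product using (Σ; _×_)
open import Data.Empty using (⊥-elim)

lemma5p1 : (p : ℕ) → Prime p → p ≢ 2 → (a : ℕ) → 1 ≤ a
    → (t n : ℤ) → disc t n < 0ℤ → (+ p) ∣ disc t n
    → (P : Elt) → HasAddOrder (p ^ a) P (p ^ a)
    → Σ ℕ λ b → (b ≤ a)
        × IsoCyc² (p ^ a) (InM t n (p ^ a) P) (p ^ a) (p ^ b)
        × ClassCount (p ^ a) (InOrbit t n (p ^ a) P) (p ^ (a + b ∸ 1) * (p ∸ 1))
lemma5p1 zero p-prime = ⊥-elim (¬prime[0] p-prime)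
lemma5p1 (suc p₁) p-prime p≢2 zero ()
lemma5p1 (suc p₁) p-prime p≢2 (suc a) _ t n _ p∣disc P order =
  PointOfFullOrder.conclusion p₁ p-prime p≢2 t n (Congruence.∣⇒≡0-mod (∣ᵤ⇒∣ p∣disc)) a P order
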